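{- Let $\varepsilon>0$, $d\in[0,1]$, $M',n\in\mathbb N$, let $M=M(\varepsilon,M')$ be the integer given by the degree form of the multigraph regularity lemma, and let $G$ be a standard multigraph on $n$ vertices. Let $\{V_0,V_1,\dots,V_k\}$ be a partition of $V(G)$ and $G'$ a spanning submultigraph of $G$ satisfying: (1) $|V_0|\leq\varepsilon n$; (2) $M'\leq k\leq M$ and $\frac{1-\varepsilon}{M}n\leq \frac{n-|V_0|}{k}=|V_1|=\dots=|V_k|\leq\frac{n}{M'}$; (3) $d_{G'}(v)>d_G(v)-(4d+2\varepsilon)n$ for all $v\in V(G)$; (4) $G'[V_i]$ has no edges for all $i\in[k]$; (5) for all $1\leq i<j\leq k$ and $c\in\{1,2\}$, the bipartite graph $(V_i,V_j)^c_{G'}$ is $\varepsilon$-regular with density either $0$ or at least $d$. Let $\Gamma$ be the reduced multigraph on vertex set $\{V_1,\dots,V_k\}$ in which $V_iV_j$ is a heavy edge if $(V_i,V_j)^2_{G'}$ has density at least $d$, a light edge if $(V_i,V_j)^2_{G'}$ has density $0$ and $(V_i,V_j)^1_{G'}$ has density at least $d$, and a non-edge otherwise. Then $\delta(\Gamma)\geq (\delta(G)/n-(8d+6\varepsilon))|\Gamma|$.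
   Context: A standard multigraph is a loopless multigraph in which any two distinct vertices are joined by $\mu\in\{0,1,2\}$ edges (light if $1$, heavy if $2$); degrees count edges with multiplicity. For disjoint $A,B\subseteq V(G')$ and $c\in\{1,2\}$, $(A,B)^c_{G'}$ is the bipartite simple graph with classes $A,B$ in which $a\in A$, $b\in B$ are adjacent iff $\mu_{G'}(ab)=c$. The density of a bipartite graph with classes $A,B$ is $e(A,B)/(|A||B|)$; it is $\varepsilon$-regular if for all $X\subseteq A$, $Y\subseteq B$ with $|X|>\varepsilon|A|$, $|Y|>\varepsilon|B|$ we have $|d(X,Y)-d(A,B)|<\varepsilon$. The degree form of the multigraph regularity lemma states: for any $\varepsilon>0$ and $M'\in\mathbb N$ there exists $M=M(\varepsilon,M')$ such that for every standard multigraph $G$ on $n$ vertices and every $0\leq d\leq1$ there exist a partition and spanning submultigraph $G'$ satisfying (1)–(5) above.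
   Formalization: The constants $\varepsilon>0$ and $d\in[0,1]$ range over the rationals. -}

module Defs where

open import Data.Nat as ℕ using (ℕ; zero; suc; _⊓_)
open import Data.Fin using (Fin; zero; suc; _<_)
open import Data.Fin.Properties using () renaming (_≟_ to _≟ᶠ_)
open import Data.Fin.Subset using (Subset; _∈_; _⊆_; ∣_∣; inside; outside)
open import Data.Vec using (tabulate; lookup)
open import Data.Bool using (Bool; true; false; if_then_else_; _∧_)
open import Data.Integer using (+_)
open import Data.Rational using (ℚ; 0ℚ; _/_; _≤ᵇ_)
open import Data.Rational.Properties using () renaming (_≟_ to _≟ℚ_)
open import Data.Product using (_×_; Σ)
open import Data.Sum using (_⊎_)
open import Relation.Binary.PropositionalEquality using (_≡_)
open import Relation.Nullary.Decidable using (⌊_⌋)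

ℕ→ℚ : ℕ → ℚ
ℕ→ℚ m = + m / 1

-- a / b as a rational (b = 0 never occurs where used; conventionally 0)
frac : ℕ → ℕ → ℚ
frac a zero    = 0ℚ
frac a (suc b) = + a / suc b

sumFin : (n : ℕ) → (Fin n → ℕ) → ℕ
sumFin zero    f = 0
sumFin (suc n) f = f zero ℕ.+ sumFin n (λ i → f (suc i))

minFin : (n : ℕ) → ℕ → (Fin n → ℕ) → ℕ
minFin zero    s f = s
minFin (suc n) s f = f zero ⊓ minFin n s (λ i → f (suc i))

record StdMultigraph (n : ℕ) : Set where
  field
    μ      : Fin n → Fin n → ℕ
    μ≤2    : ∀ x y → μ x y ℕ.≤ 2
    μ-sym  : ∀ x y → μ x y ≡ μ y x
    μ-loop : ∀ x → μ x x ≡ 0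
open StdMultigraph public

deg : ∀ {n} → StdMultigraph n → Fin n → ℕ
deg {n} G v = sumFin n (λ u → μ G v u)

-- minimum degree δ(G).  The sentinel 2n exceeds every degree (each degree
-- is at most 2(n-1)), so for n ≥ 1 this is exactly the minimum degree.
-- (For n = 0 it is 0.)
minDeg : ∀ {n} → StdMultigraph n → ℕ
minDeg {n} G = minFin n (2 ℕ.* n) (deg G)

_⊑_ : ∀ {n} → StdMultigraph n → StdMultigraph n → Set
G' ⊑ G = ∀ x y → μ G' x y ℕ.≤ μ G x y

-- e(X,Y) in (A,B)^c_{G'}: number of pairs x ∈ X, y ∈ Y with μ(xy) = c
eCount : ∀ {n} → StdMultigraph n → ℕ → Subset n → Subset n → ℕ
eCount {n} G c X Y =
  sumFin n (λ x → sumFin n (λ y →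
    if lookup X x ∧ lookup Y y ∧ ⌊ μ G x y ℕ.≟ c ⌋ then 1 else 0))

density : ∀ {n} → StdMultigraph n → ℕ → Subset n → Subset n → ℚ
density G c X Y = frac (eCount G c X Y) (∣ X ∣ ℕ.* ∣ Y ∣)

IsRegular : ∀ {n} → ℚ → StdMultigraph n → ℕ → Subset n → Subset n → Set
IsRegular {n} ε G c A B =
  ∀ (X Y : Subset n) → X ⊆ A → Y ⊆ B →
  ε Data.Rational.* ℕ→ℚ ∣ A ∣ Data.Rational.< ℕ→ℚ ∣ X ∣ →
  ε Data.Rational.* ℕ→ℚ ∣ B ∣ Data.Rational.< ℕ→ℚ ∣ Y ∣ →
  Data.Rational.∣ density G c X Y Data.Rational.- density G c A B ∣
    Data.Rational.< ε

-- Partitions {V_0, V_1, ..., V_k} of Fin n, given by the map sending a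
-- vertex to the index of its class (index zero = V_0).

classOf : ∀ {n k} → (Fin n → Fin (suc k)) → Fin (suc k) → Subset n
classOf part i = tabulate (λ v → ⌊ part v ≟ᶠ i ⌋)

-- Reduced multigraph Γ on {V_1,...,V_k} (indexed by Fin k, vertex i
-- standing for V_{i+1}).

reducedμ : ∀ {n k} → ℚ → StdMultigraph n → (Fin n → Fin (suc k)) →
           Fin k → Fin k → ℕ
reducedμ d G' part i j =
  if ⌊ i ≟ᶠ j ⌋ then 0 else
  (if d ≤ᵇ density G' 2 Vi Vj then 2 else
   (if ⌊ density G' 2 Vi Vj ≟ℚ 0ℚ ⌋ ∧ (d ≤ᵇ density G' 1 Vi Vj) then 1 else 0))
  where
  Vi = classOf part (suc i)
  Vj = classOf part (suc j)

reducedDeg : ∀ {n k} → ℚ → StdMultigraph n → (Fin n → Fin (suc k)) →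
             Fin k → ℕ
reducedDeg {k = k} d G' part i = sumFin k (λ j → reducedμ d G' part i j)

-- δ(Γ) (sentinel 2k exceeds every degree; equals 0 when k = 0)
reducedMinDeg : ∀ {n k} → ℚ → StdMultigraph n → (Fin n → Fin (suc k)) → ℕ
reducedMinDeg {k = k} d G' part = minFin k (2 ℕ.* k) (reducedDeg d G' part)

module Submission where

-- Take a cluster V_i and a vertex v ∈ V_i.  A G'-edge from v into a cluster V_j
-- has multiplicity at most μ_Γ(V_i V_j): inside a cluster G' has no edges, and
-- a pair whose c-density is below d has c-density 0 by (5), hence no edge of
-- multiplicity c.  So d_G'(v) ≤ 2|V_0| + s·d_Γ(V_i), and together with (1), (3)
-- and δ(G) ≤ d_G(v) this gives δ(G) − (4d + 4ε)n < s·d_Γ(V_i).  As ks ≤ n,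
-- multiplying by k/n turns this into the claimed bound on d_Γ(V_i).

open import Defs
open import Data.Nat using (ℕ; suc; NonZero; _∸_)
open import Data.Fin using (Fin; zero; suc)
open import Data.Fin.Subset using (∣_∣)
open import Data.Integer using (+_)
open import Data.Rational using (ℚ; 0ℚ; 1ℚ; _/_; _+_; _-_; _*_; _≤_; _<_)
open import Data.Product using (_×_)
open import Data.Sum using (_⊎_)
open import Relation.Binary.PropositionalEquality using (_≡_)

open import Data.Bool using (Bool; true; false; T; if_then_else_; _∧_)
open import Data.Bool.Properties using (T-∧)
import Data.Fin.Properties as FinP
open import Data.Fin.Properties using () renaming (_≟_ to _≟ᶠ_)
open import Data.Fin.Subset using (Subset; _∈_; Nonempty)
open import Data.Fin.Subset.Properties using (nonempty?; Empty-unique; ∣⊥∣≡0; ∣p∣≤∣x∷p∣)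
import Data.Integer as ℤ
import Data.Integer.Properties as ℤP
open import Data.Nat using (zero)
import Data.Nat as ℕ
import Data.Nat.Properties as ℕP
open import Data.Product using (_,_; proj₂)
open import Data.Rational using (_≤ᵇ_; toℚᵘ; NonNegative; nonNegative)
import Data.Rational.Properties as ℚP
open import Data.Rational.Properties using () renaming (_≟_ to _≟ℚ_)
open import Data.Rational.Solver using (module +-*-Solver)
open import Data.Rational.Unnormalised using (ℚᵘ; mkℚᵘ; *≡*; _≃_)
import Data.Rational.Unnormalised as ℚᵘ
import Data.Rational.Unnormalised.Properties as ℚᵘP
open import Data.Sum using (inj₁; inj₂; [_,_]′)
open import Data.Vec using (_∷_; here; there; tabulate; lookup)
open import Data.Vec.Properties using (lookup∘tabulate; []=⇒lookup; lookup⇒[]=)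
open import Function using (_∘_; id)
open import Function.Bundles using (Equivalence)
open import Relation.Binary.Definitions using (tri<; tri≈; tri>)
open import Relation.Binary.PropositionalEquality
  using (_≢_; refl; sym; trans; cong; cong₂; subst; module ≡-Reasoning)
open import Relation.Nullary using (¬_; yes; no; contradiction)
open import Relation.Nullary.Decidable using (⌊_⌋; isYes≗does; dec-true; toWitness; fromWitness)

open +-*-Solver using (solve; _:=_; _:+_; _:-_; _:*_)
open import Algebra.Properties.Semiring.Sum ℕP.+-*-semiring
  using (sum; sum-cong-≗; sum-replicate-zero; sum-remove; ∑-comm; *-distribˡ-sum)

sumFin≡sum : ∀ n (f : Fin n → ℕ) → sumFin n f ≡ sum f
sumFin≡sum zero    f = refl
sumFin≡sum (suc n) f = cong (f zero ℕ.+_) (sumFin≡sum n (f ∘ suc))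

sum-mono-≤ : ∀ {n} {f g : Fin n → ℕ} → (∀ i → f i ℕ.≤ g i) → sum f ℕ.≤ sum g
sum-mono-≤ {zero}  _   = ℕ.z≤n
sum-mono-≤ {suc n} f≤g = ℕP.+-mono-≤ (f≤g zero) (sum-mono-≤ (f≤g ∘ suc))

sum-≤-* : ∀ {n c} {f : Fin n → ℕ} → (∀ i → f i ℕ.≤ c) → sum f ℕ.≤ n ℕ.* c
sum-≤-* {zero}  _   = ℕ.z≤n
sum-≤-* {suc n} f≤c = ℕP.+-mono-≤ (f≤c zero) (sum-≤-* (f≤c ∘ suc))

f≤sum : ∀ {n} (f : Fin n → ℕ) i → f i ℕ.≤ sum f
f≤sum {suc n} f i = ℕP.≤-trans (ℕP.m≤m+n (f i) _) (ℕP.≤-reflexive (sym (sum-remove {i = i} f)))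

𝟙 : Bool → ℕ
𝟙 b = if b then 1 else 0

sum-select : ∀ {m} (h : Fin m → ℕ) j → sum (λ c → h c ℕ.* 𝟙 ⌊ j ≟ᶠ c ⌋) ≡ h j
sum-select {suc m} h zero = begin
  h zero ℕ.* 1 ℕ.+ sum (λ c → h (suc c) ℕ.* 0)
    ≡⟨ cong₂ ℕ._+_ (ℕP.*-identityʳ (h zero)) (sum-cong-≗ (ℕP.*-zeroʳ ∘ h ∘ suc)) ⟩
  h zero ℕ.+ sum {m} (λ _ → 0)  ≡⟨ cong (h zero ℕ.+_) (sum-replicate-zero m) ⟩
  h zero ℕ.+ 0                  ≡⟨ ℕP.+-identityʳ (h zero) ⟩
  h zero                        ∎
  where open ≡-Reasoning
sum-select {suc m} h (suc j) = begin
  h zero ℕ.* 0 ℕ.+ sum (λ c → h (suc c) ℕ.* 𝟙 ⌊ suc j ≟ᶠ suc c ⌋)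
    ≡⟨ cong₂ ℕ._+_ (ℕP.*-zeroʳ (h zero)) (sum-cong-≗ λ c → cong (λ b → h (suc c) ℕ.* 𝟙 b) (⌊suc≟suc⌋ c)) ⟩
  sum (λ c → h (suc c) ℕ.* 𝟙 ⌊ j ≟ᶠ c ⌋)
    ≡⟨ sum-select (h ∘ suc) j ⟩
  h (suc j) ∎
  where
  open ≡-Reasoning
  ⌊suc≟suc⌋ : ∀ c → ⌊ suc j ≟ᶠ suc c ⌋ ≡ ⌊ j ≟ᶠ c ⌋
  ⌊suc≟suc⌋ c = trans (isYes≗does _) (sym (isYes≗does (j ≟ᶠ c)))

minFin≤ : ∀ {n} s (f : Fin n → ℕ) i → minFin n s f ℕ.≤ f i
minFin≤ s f zero    = ℕP.m⊓n≤m (f zero) _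
minFin≤ s f (suc i) = ℕP.≤-trans (ℕP.m⊓n≤n (f zero) _) (minFin≤ s (f ∘ suc) i)

minFin-elim : ∀ {ℓ} (P : ℕ → Set ℓ) {n s} {f : Fin n → ℕ} → (∀ i → f i ℕ.≤ s) →
              (n ≡ 0 → P s) → (∀ i → P (f i)) → P (minFin n s f)
minFin-elim P {zero}        _   P-s _   = P-s refl
minFin-elim P {suc zero}    f≤s _   P-f = subst P (sym (ℕP.m≤n⇒m⊓n≡m (f≤s zero))) (P-f zero)
minFin-elim P {suc (suc n)} {s} {f} f≤s _ P-f =
  [ (λ min≡f₀ → subst P (sym min≡f₀) (P-f zero))
  , (λ min≡rest → subst P (sym min≡rest) (minFin-elim P (f≤s ∘ suc) (λ ()) (P-f ∘ suc)))
  ]′ (ℕP.⊓-sel (f zero) (minFin (suc n) s (f ∘ suc)))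

∣tabulate∣≡sum : ∀ {n} (f : Fin n → Bool) → ∣ tabulate f ∣ ≡ sum (𝟙 ∘ f)
∣tabulate∣≡sum {zero}  f = refl
∣tabulate∣≡sum {suc n} f with f zero
... | true  = cong suc (∣tabulate∣≡sum (f ∘ suc))
... | false = ∣tabulate∣≡sum (f ∘ suc)

x∈p⇒0<∣p∣ : ∀ {n x} {p : Subset n} → x ∈ p → 0 ℕ.< ∣ p ∣
x∈p⇒0<∣p∣              here        = ℕ.s≤s ℕ.z≤n
x∈p⇒0<∣p∣ {p = y ∷ p} (there x∈p) = ℕP.≤-trans (x∈p⇒0<∣p∣ x∈p) (∣p∣≤∣x∷p∣ y p)

0<∣p∣⇒Nonempty : ∀ {n} (p : Subset n) → 0 ℕ.< ∣ p ∣ → Nonempty p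
0<∣p∣⇒Nonempty {n} p 0<∣p∣ with nonempty? p
... | yes p≢∅ = p≢∅
... | no  p≡∅ = contradiction (trans (cong ∣_∣ (Empty-unique p≡∅)) (∣⊥∣≡0 n)) (ℕP.>⇒≢ 0<∣p∣)

module _ {n k} (part : Fin n → Fin (suc k)) where

  ∈-classOf⁺ : ∀ {x c} → part x ≡ c → x ∈ classOf part c
  ∈-classOf⁺ {x} {c} px≡c =
    lookup⇒[]= x _ (trans (lookup∘tabulate _ x) (trans (isYes≗does _) (dec-true (part x ≟ᶠ c) px≡c)))

  ∈-classOf⁻ : ∀ {x c} → x ∈ classOf part c → part x ≡ c
  ∈-classOf⁻ {x} x∈ = toWitness (subst T (trans (sym ([]=⇒lookup x∈)) (lookup∘tabulate _ x)) _)

  ∣classOf∣≡sum : ∀ c → ∣ classOf part c ∣ ≡ sum (λ x → 𝟙 ⌊ part x ≟ᶠ c ⌋)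
  ∣classOf∣≡sum c = ∣tabulate∣≡sum (λ x → ⌊ part x ≟ᶠ c ⌋)

  sum-by-classes : (h : Fin (suc k) → ℕ) → sum (h ∘ part) ≡ sum (λ c → h c ℕ.* ∣ classOf part c ∣)
  sum-by-classes h = begin
    sum (h ∘ part)
      ≡⟨ sum-cong-≗ (sum-select h ∘ part) ⟨
    sum (λ x → sum (λ c → h c ℕ.* 𝟙 ⌊ part x ≟ᶠ c ⌋))
      ≡⟨ ∑-comm (λ x c → h c ℕ.* 𝟙 ⌊ part x ≟ᶠ c ⌋) ⟩
    sum (λ c → sum (λ x → h c ℕ.* 𝟙 ⌊ part x ≟ᶠ c ⌋))
      ≡⟨ sum-cong-≗ (λ c → *-distribˡ-sum (h c) (λ x → 𝟙 ⌊ part x ≟ᶠ c ⌋)) ⟨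
    sum (λ c → h c ℕ.* sum (λ x → 𝟙 ⌊ part x ≟ᶠ c ⌋))
      ≡⟨ sum-cong-≗ (λ c → cong (h c ℕ.*_) (∣classOf∣≡sum c)) ⟨
    sum (λ c → h c ℕ.* ∣ classOf part c ∣)
      ∎
    where open ≡-Reasoning

edgeIndicator : ∀ {n} → StdMultigraph n → ℕ → Subset n → Subset n → Fin n → Fin n → ℕ
edgeIndicator G c X Y x y = 𝟙 (lookup X x ∧ lookup Y y ∧ ⌊ μ G x y ℕ.≟ c ⌋)

eCount≡sum : ∀ {n} (G : StdMultigraph n) c X Y →
             eCount G c X Y ≡ sum (λ x → sum (edgeIndicator G c X Y x))
eCount≡sum {n} G c X Y =
  trans (sumFin≡sum n _) (sum-cong-≗ λ x → sumFin≡sum n (edgeIndicator G c X Y x))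

edgeIndicator-sym : ∀ {n} (G : StdMultigraph n) c X Y x y →
                    edgeIndicator G c X Y x y ≡ edgeIndicator G c Y X y x
edgeIndicator-sym G c X Y x y rewrite μ-sym G x y with lookup X x | lookup Y y
... | true  | true  = refl
... | true  | false = refl
... | false | true  = refl
... | false | false = refl

eCount-sym : ∀ {n} (G : StdMultigraph n) c X Y → eCount G c X Y ≡ eCount G c Y X
eCount-sym G c X Y = begin
  eCount G c X Y
    ≡⟨ eCount≡sum G c X Y ⟩
  sum (λ x → sum (λ y → edgeIndicator G c X Y x y))
    ≡⟨ ∑-comm (edgeIndicator G c X Y) ⟩
  sum (λ y → sum (λ x → edgeIndicator G c X Y x y))
    ≡⟨ sum-cong-≗ (λ y → sum-cong-≗ (λ x → edgeIndicator-sym G c X Y x y)) ⟩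
  sum (λ y → sum (λ x → edgeIndicator G c Y X y x))
    ≡⟨ eCount≡sum G c Y X ⟨
  eCount G c Y X
    ∎
  where open ≡-Reasoning

density-sym : ∀ {n} (G : StdMultigraph n) c X Y → density G c X Y ≡ density G c Y X
density-sym G c X Y = cong₂ frac (eCount-sym G c X Y) (ℕP.*-comm ∣ X ∣ ∣ Y ∣)

frac-pos : ∀ {a b} → 0 ℕ.< a → 0 ℕ.< b → 0ℚ < frac a b
frac-pos {suc a} {suc b} _ _ = ℚP.positive⁻¹ _ {{ℚP.normalize-pos (suc a) (suc b)}}

density≡0⇒μ≢ : ∀ {n} (G : StdMultigraph n) c {X Y x y} → x ∈ X → y ∈ Y →
               density G c X Y ≡ 0ℚ → μ G x y ≢ c
density≡0⇒μ≢ G c {X} {Y} {x} {y} x∈X y∈Y density≡0 μ≡c =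
  ℚP.<-irrefl (sym density≡0) (frac-pos 0<eCount (ℕP.*-mono-< (x∈p⇒0<∣p∣ x∈X) (x∈p⇒0<∣p∣ y∈Y)))
  where
  edge : edgeIndicator G c X Y x y ≡ 1
  edge rewrite []=⇒lookup x∈X | []=⇒lookup y∈Y =
    cong 𝟙 (trans (isYes≗does _) (dec-true (μ G x y ℕ.≟ c) μ≡c))
  0<eCount : 0 ℕ.< eCount G c X Y
  0<eCount = begin
    1                                          ≡⟨ edge ⟨
    edgeIndicator G c X Y x y                  ≤⟨ f≤sum _ y ⟩
    sum (edgeIndicator G c X Y x)              ≤⟨ f≤sum (λ x → sum (edgeIndicator G c X Y x)) x ⟩
    sum (λ x → sum (edgeIndicator G c X Y x))  ≡⟨ eCount≡sum G c X Y ⟨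
    eCount G c X Y                             ∎
    where open ℕP.≤-Reasoning

≤-if : ∀ {m x y} b → (T b → m ℕ.≤ x) → (¬ T b → m ℕ.≤ y) → m ℕ.≤ (if b then x else y)
≤-if true  m≤x _   = m≤x _
≤-if false _   m≤y = m≤y id

if-≤ : ∀ {x y z} b → x ℕ.≤ z → y ℕ.≤ z → (if b then x else y) ℕ.≤ z
if-≤ true  x≤z _   = x≤z
if-≤ false _   y≤z = y≤z

module _ {n k} (d : ℚ) (G' : StdMultigraph n) (part : Fin n → Fin (suc k)) where

  private
    V : Fin k → Subset n
    V i = classOf part (suc i)

  reducedμ≤2 : ∀ i j → reducedμ d G' part i j ℕ.≤ 2
  reducedμ≤2 i j =
    if-≤ ⌊ i ≟ᶠ j ⌋ ℕ.z≤n
      (if-≤ (d ≤ᵇ D 2) ℕP.≤-refl (if-≤ (⌊ D 2 ≟ℚ 0ℚ ⌋ ∧ (d ≤ᵇ D 1)) (ℕ.s≤s ℕ.z≤n) ℕ.z≤n))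
    where
    D : ℕ → ℚ
    D c = density G' c (V i) (V j)

  reducedDeg≤2k : ∀ i → reducedDeg d G' part i ℕ.≤ 2 ℕ.* k
  reducedDeg≤2k i = begin
    reducedDeg d G' part i      ≡⟨ sumFin≡sum k _ ⟩
    sum (reducedμ d G' part i)  ≤⟨ sum-≤-* (reducedμ≤2 i) ⟩
    k ℕ.* 2                     ≡⟨ ℕP.*-comm k 2 ⟩
    2 ℕ.* k                     ∎
    where open ℕP.≤-Reasoning

  module _
    (noEdgeInClass : ∀ (i : Fin k) (x y : Fin n) → part x ≡ suc i → part y ≡ suc i → μ G' x y ≡ 0)
    (dichotomy : ∀ (i j : Fin k) → i Data.Fin.< j → (c : ℕ) → c ≡ 1 ⊎ c ≡ 2 →
      density G' c (V i) (V j) ≡ 0ℚ ⊎ d ≤ density G' c (V i) (V j)) where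

    dichotomy-≢ : ∀ {i j} → i ≢ j → ∀ c → c ≡ 1 ⊎ c ≡ 2 →
                  density G' c (V i) (V j) ≡ 0ℚ ⊎ d ≤ density G' c (V i) (V j)
    dichotomy-≢ {i} {j} i≢j c c∈ with FinP.<-cmp i j
    ... | tri< i<j _ _ = dichotomy i j i<j c c∈
    ... | tri≈ _ i≡j _ = contradiction i≡j i≢j
    ... | tri> _ _ j<i =
      subst (λ δ → δ ≡ 0ℚ ⊎ d ≤ δ) (density-sym G' c (V j) (V i)) (dichotomy j i j<i c c∈)

    sparse⇒density≡0 : ∀ {i j} → i ≢ j → ∀ c → c ≡ 1 ⊎ c ≡ 2 →
                       ¬ T (d ≤ᵇ density G' c (V i) (V j)) → density G' c (V i) (V j) ≡ 0ℚ
    sparse⇒density≡0 i≢j c c∈ sparse with dichotomy-≢ i≢j c c∈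
    ... | inj₁ density≡0 = density≡0
    ... | inj₂ d≤density = contradiction (ℚP.≤⇒≤ᵇ d≤density) sparse

    μ≤reducedμ : ∀ {i j x y} → part x ≡ suc i → part y ≡ suc j → μ G' x y ℕ.≤ reducedμ d G' part i j
    μ≤reducedμ {i} {j} {x} {y} px py =
      ≤-if ⌊ i ≟ᶠ j ⌋ (λ i≡j → ℕP.≤-reflexive (sameClass (toWitness i≡j))) λ ¬i≡j →
      let i≢j = ¬i≡j ∘ fromWitness in
      ≤-if (d ≤ᵇ D 2) (λ _ → μ≤2 G' x y) λ sparse₂ →
      let μ≤1 = ℕP.m<1+n⇒m≤n (ℕP.≤∧≢⇒< (μ≤2 G' x y) (noEdge 2 (inj₂ refl) i≢j sparse₂)) in
      ≤-if (⌊ D 2 ≟ℚ 0ℚ ⌋ ∧ (d ≤ᵇ D 1)) (λ _ → μ≤1) λ ¬light →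
      let sparse₁ = λ dense₁ → ¬light (Equivalence.from T-∧
                      (fromWitness (sparse⇒density≡0 i≢j 2 (inj₂ refl) sparse₂) , dense₁)) in
      ℕP.m<1+n⇒m≤n (ℕP.≤∧≢⇒< μ≤1 (noEdge 1 (inj₁ refl) i≢j sparse₁))
      where
      D : ℕ → ℚ
      D c = density G' c (V i) (V j)
      sameClass : i ≡ j → μ G' x y ≡ 0
      sameClass refl = noEdgeInClass i x y px py
      noEdge : ∀ c → c ≡ 1 ⊎ c ≡ 2 → i ≢ j → ¬ T (d ≤ᵇ D c) → μ G' x y ≢ c
      noEdge c c∈ i≢j sparse = density≡0⇒μ≢ G' c (∈-classOf⁺ part px) (∈-classOf⁺ part py)
                                 (sparse⇒density≡0 i≢j c c∈ sparse)

    deg≤reducedDeg : (s : ℕ) → (∀ i → ∣ V i ∣ ≡ s) → ∀ {i x} → part x ≡ suc i →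
                     deg G' x ℕ.≤ 2 ℕ.* ∣ classOf part zero ∣ ℕ.+ s ℕ.* reducedDeg d G' part i
    deg≤reducedDeg s ∣V∣≡s {i} {x} px = begin
      deg G' x
        ≡⟨ sumFin≡sum n _ ⟩
      sum (μ G' x)
        ≤⟨ sum-mono-≤ μ≤weight ⟩
      sum (weight ∘ part)
        ≡⟨ sum-by-classes part weight ⟩
      2 ℕ.* ∣ V₀ ∣ ℕ.+ sum (λ j → Γ j ℕ.* ∣ V j ∣)
        ≡⟨ cong (2 ℕ.* ∣ V₀ ∣ ℕ.+_) (sum-cong-≗ λ j → trans (cong (Γ j ℕ.*_) (∣V∣≡s j)) (ℕP.*-comm _ s)) ⟩
      2 ℕ.* ∣ V₀ ∣ ℕ.+ sum (λ j → s ℕ.* Γ j)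
        ≡⟨ cong (2 ℕ.* ∣ V₀ ∣ ℕ.+_) (*-distribˡ-sum s Γ) ⟨
      2 ℕ.* ∣ V₀ ∣ ℕ.+ s ℕ.* sum Γ
        ≡⟨ cong (λ t → 2 ℕ.* ∣ V₀ ∣ ℕ.+ s ℕ.* t) (sumFin≡sum k Γ) ⟨
      2 ℕ.* ∣ V₀ ∣ ℕ.+ s ℕ.* reducedDeg d G' part i
        ∎
      where
      open ℕP.≤-Reasoning
      V₀ : Subset n
      V₀ = classOf part zero
      Γ : Fin k → ℕ
      Γ = reducedμ d G' part i
      weight : Fin (suc k) → ℕ
      weight zero    = 2
      weight (suc j) = Γ j
      μ≤weight : ∀ y → μ G' x y ℕ.≤ weight (part y)
      μ≤weight y with part y in py
      ... | zero  = μ≤2 G' x y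
      ... | suc j = μ≤reducedμ px py

private
  ℕ→ℚᵘ : ℕ → ℚᵘ
  ℕ→ℚᵘ m = mkℚᵘ (+ m) 0

  toℚᵘ-ℕ→ℚ : ∀ m → toℚᵘ (ℕ→ℚ m) ≃ ℕ→ℚᵘ m
  toℚᵘ-ℕ→ℚ m = ℚP.toℚᵘ-fromℚᵘ (ℕ→ℚᵘ m)

ℕ→ℚ-+ : ∀ m n → ℕ→ℚ (m ℕ.+ n) ≡ ℕ→ℚ m + ℕ→ℚ n
ℕ→ℚ-+ m n = ℚP.toℚᵘ-injective (begin
  toℚᵘ (ℕ→ℚ (m ℕ.+ n))            ≈⟨ toℚᵘ-ℕ→ℚ (m ℕ.+ n) ⟩
  ℕ→ℚᵘ (m ℕ.+ n)                  ≈⟨ *≡* (cong (ℤ._* + 1) (trans (ℤP.pos-+ m n)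
                                        (sym (cong₂ ℤ._+_ (ℤP.*-identityʳ (+ m)) (ℤP.*-identityʳ (+ n)))))) ⟩
  ℕ→ℚᵘ m ℚᵘ.+ ℕ→ℚᵘ n              ≈⟨ ℚᵘP.+-cong (toℚᵘ-ℕ→ℚ m) (toℚᵘ-ℕ→ℚ n) ⟨
  toℚᵘ (ℕ→ℚ m) ℚᵘ.+ toℚᵘ (ℕ→ℚ n)  ≈⟨ ℚP.toℚᵘ-homo-+ (ℕ→ℚ m) (ℕ→ℚ n) ⟨
  toℚᵘ (ℕ→ℚ m + ℕ→ℚ n)            ∎)
  where open ℚᵘP.≃-Reasoning

ℕ→ℚ-* : ∀ m n → ℕ→ℚ (m ℕ.* n) ≡ ℕ→ℚ m * ℕ→ℚ n
ℕ→ℚ-* m n = ℚP.toℚᵘ-injective (begin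
  toℚᵘ (ℕ→ℚ (m ℕ.* n))            ≈⟨ toℚᵘ-ℕ→ℚ (m ℕ.* n) ⟩
  ℕ→ℚᵘ (m ℕ.* n)                  ≈⟨ *≡* (cong (ℤ._* + 1) (ℤP.pos-* m n)) ⟩
  ℕ→ℚᵘ m ℚᵘ.* ℕ→ℚᵘ n              ≈⟨ ℚᵘP.*-cong (toℚᵘ-ℕ→ℚ m) (toℚᵘ-ℕ→ℚ n) ⟨
  toℚᵘ (ℕ→ℚ m) ℚᵘ.* toℚᵘ (ℕ→ℚ n)  ≈⟨ ℚP.toℚᵘ-homo-* (ℕ→ℚ m) (ℕ→ℚ n) ⟨
  toℚᵘ (ℕ→ℚ m * ℕ→ℚ n)            ∎)
  where open ℚᵘP.≃-Reasoning

/-*-cancel : ∀ m n .{{_ : NonZero n}} → (+ m / n) * ℕ→ℚ n ≡ ℕ→ℚ m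
/-*-cancel m n@(suc n-1) = ℚP.toℚᵘ-injective (begin
  toℚᵘ ((+ m / n) * ℕ→ℚ n)          ≈⟨ ℚP.toℚᵘ-homo-* (+ m / n) (ℕ→ℚ n) ⟩
  toℚᵘ (+ m / n) ℚᵘ.* toℚᵘ (ℕ→ℚ n)  ≈⟨ ℚᵘP.*-cong (ℚP.toℚᵘ-fromℚᵘ (mkℚᵘ (+ m) n-1)) (toℚᵘ-ℕ→ℚ n) ⟩
  mkℚᵘ (+ m) n-1 ℚᵘ.* ℕ→ℚᵘ n        ≈⟨ *≡* (trans (ℤP.*-identityʳ _)
                                          (cong (λ t → + m ℤ.* + t) (sym (ℕP.*-identityʳ n)))) ⟩
  ℕ→ℚᵘ m                            ≈⟨ toℚᵘ-ℕ→ℚ m ⟨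
  toℚᵘ (ℕ→ℚ m)                      ∎)
  where open ℚᵘP.≃-Reasoning

ℕ→ℚ-nonNeg : ∀ m → NonNegative (ℕ→ℚ m)
ℕ→ℚ-nonNeg m = ℚP.normalize-nonNeg m 1

0≤ℕ→ℚ : ∀ m → 0ℚ ≤ ℕ→ℚ m
0≤ℕ→ℚ m = ℚP.nonNegative⁻¹ (ℕ→ℚ m) {{ℕ→ℚ-nonNeg m}}

ℕ→ℚ-mono-≤ : ∀ {m n} → m ℕ.≤ n → ℕ→ℚ m ≤ ℕ→ℚ n
ℕ→ℚ-mono-≤ {m} {n} m≤n = begin
  ℕ→ℚ m                ≡⟨ ℚP.+-identityʳ (ℕ→ℚ m) ⟨
  ℕ→ℚ m + 0ℚ           ≤⟨ ℚP.+-monoʳ-≤ (ℕ→ℚ m) (0≤ℕ→ℚ (n ∸ m)) ⟩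
  ℕ→ℚ m + ℕ→ℚ (n ∸ m)  ≡⟨ ℕ→ℚ-+ m (n ∸ m) ⟨
  ℕ→ℚ (m ℕ.+ (n ∸ m))  ≡⟨ cong ℕ→ℚ (ℕP.m+[n∸m]≡n m≤n) ⟩
  ℕ→ℚ n                ∎
  where open ℚP.≤-Reasoning

scaled-<⇒≤ : ∀ {a N S D} K .{{_ : NonNegative K}} .{{_ : NonNegative S}} →
             0ℚ ≤ D → K * S ≤ N → a * N < S * D → a * K ≤ D
scaled-<⇒≤ {a} {N} {S} {D} K 0≤D KS≤N aN<SD with ℚP.≤-total a 0ℚ
... | inj₁ a≤0 = begin
  a * K   ≤⟨ ℚP.*-monoʳ-≤-nonNeg K a≤0 ⟩
  0ℚ * K  ≡⟨ ℚP.*-zeroˡ K ⟩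
  0ℚ      ≤⟨ 0≤D ⟩
  D       ∎
  where open ℚP.≤-Reasoning
... | inj₂ 0≤a = ℚP.<⇒≤ (ℚP.*-cancelʳ-<-nonNeg S (begin-strict
  a * K * S    ≡⟨ ℚP.*-assoc a K S ⟩
  a * (K * S)  ≤⟨ ℚP.*-monoˡ-≤-nonNeg a {{nonNegative 0≤a}} KS≤N ⟩
  a * N        <⟨ aN<SD ⟩
  S * D        ≡⟨ ℚP.*-comm S D ⟩
  D * S        ∎))
  where open ℚP.≤-Reasoning

deficit-chain : ∀ A ε {δ g g' z N S D : ℚ} → δ ≤ g → g - A * N < g' →
                g' ≤ ℕ→ℚ 2 * z + S * D → z ≤ ε * N → δ - (A + ℕ→ℚ 2 * ε) * N < S * D
deficit-chain A ε {δ} {g} {g'} {z} {N} {S} {D} δ≤g g-AN<g' g'≤2z+SD z≤εN = begin-strict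
  δ - (A + two * ε) * N                  ≤⟨ ℚP.+-monoˡ-≤ _ δ≤g ⟩
  g - (A + two * ε) * N                  ≡⟨ solve 5 (λ g A t ε N → g :- (A :+ t :* ε) :* N
                                                               := (g :- A :* N) :- t :* (ε :* N))
                                                    refl g A two ε N ⟩
  (g - A * N) - two * (ε * N)            <⟨ ℚP.+-monoˡ-< _ g-AN<g' ⟩
  g' - two * (ε * N)                     ≤⟨ ℚP.+-monoˡ-≤ _ g'≤2z+SD ⟩
  two * z + S * D - two * (ε * N)        ≤⟨ ℚP.+-monoˡ-≤ _ (ℚP.+-monoˡ-≤ (S * D)
                                              (ℚP.*-monoˡ-≤-nonNeg two {{ℕ→ℚ-nonNeg 2}} z≤εN)) ⟩
  two * (ε * N) + S * D - two * (ε * N)  ≡⟨ solve 3 (λ x S D → x :+ S :* D :- x := S :* D)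
                                                    refl (two * (ε * N)) S D ⟩
  S * D                                  ∎
  where
  open ℚP.≤-Reasoning
  two : ℚ
  two = ℕ→ℚ 2

coefficient-≤ : ∀ {d ε} → 0ℚ ≤ d → 0ℚ ≤ ε →
                (ℕ→ℚ 4 * d + ℕ→ℚ 2 * ε) + ℕ→ℚ 2 * ε ≤ ℕ→ℚ 8 * d + ℕ→ℚ 6 * ε
coefficient-≤ {d} {ε} 0≤d 0≤ε = begin
  A + two * ε            ≡⟨ ℚP.+-identityʳ (A + two * ε) ⟨
  A + two * ε + 0ℚ       ≤⟨ ℚP.+-monoʳ-≤ (A + two * ε) 0≤A ⟩
  A + two * ε + A        ≡⟨ solve 4 (λ f t d ε → (f :* d :+ t :* ε) :+ t :* ε :+ (f :* d :+ t :* ε)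
                                             := (f :+ f) :* d :+ (t :+ t :+ t) :* ε)
                                  refl four two d ε ⟩
  ℕ→ℚ 8 * d + ℕ→ℚ 6 * ε  ∎
  where
  open ℚP.≤-Reasoning
  four two A : ℚ
  four = ℕ→ℚ 4
  two = ℕ→ℚ 2
  A = four * d + two * ε
  0≤A : 0ℚ ≤ A
  0≤A = ℚP.+-mono-≤ (ℚP.*-monoˡ-≤-nonNeg four {{ℕ→ℚ-nonNeg 4}} 0≤d)
                    (ℚP.*-monoˡ-≤-nonNeg two {{ℕ→ℚ-nonNeg 2}} 0≤ε)

scaled-degree-bound : ∀ {ε d : ℚ} {δ g g' z s D k n : ℕ} .{{_ : NonZero n}} → 0ℚ ≤ ε → 0ℚ ≤ d →
  δ ℕ.≤ g → ℕ→ℚ g - (ℕ→ℚ 4 * d + ℕ→ℚ 2 * ε) * ℕ→ℚ n < ℕ→ℚ g' →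
  g' ℕ.≤ 2 ℕ.* z ℕ.+ s ℕ.* D → ℕ→ℚ z ≤ ε * ℕ→ℚ n → k ℕ.* s ℕ.≤ n →
  ((+ δ / n) - (ℕ→ℚ 8 * d + ℕ→ℚ 6 * ε)) * ℕ→ℚ k ≤ ℕ→ℚ D
scaled-degree-bound {ε} {d} {δ} {g} {g'} {z} {s} {D} {k} {n}
                    0≤ε 0≤d δ≤g g-AN<g' g'≤2z+sD z≤εn ks≤n = begin
  (q - (ℕ→ℚ 8 * d + ℕ→ℚ 6 * ε)) * ℕ→ℚ k
    ≤⟨ ℚP.*-monoʳ-≤-nonNeg (ℕ→ℚ k) {{ℕ→ℚ-nonNeg k}}
         (ℚP.+-monoʳ-≤ q (ℚP.neg-antimono-≤ (coefficient-≤ 0≤d 0≤ε))) ⟩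
  (q - c) * ℕ→ℚ k
    ≤⟨ scaled-<⇒≤ {a = q - c} (ℕ→ℚ k) {{ℕ→ℚ-nonNeg k}} {{ℕ→ℚ-nonNeg s}} (0≤ℕ→ℚ D) ks≤n′ qn<sD ⟩
  ℕ→ℚ D
    ∎
  where
  open ℚP.≤-Reasoning
  q c : ℚ
  q = + δ / n
  c = (ℕ→ℚ 4 * d + ℕ→ℚ 2 * ε) + ℕ→ℚ 2 * ε
  ks≤n′ : ℕ→ℚ k * ℕ→ℚ s ≤ ℕ→ℚ n
  ks≤n′ = subst (_≤ ℕ→ℚ n) (ℕ→ℚ-* k s) (ℕ→ℚ-mono-≤ ks≤n)
  g'≤2z+sD′ : ℕ→ℚ g' ≤ ℕ→ℚ 2 * ℕ→ℚ z + ℕ→ℚ s * ℕ→ℚ D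
  g'≤2z+sD′ = subst (ℕ→ℚ g' ≤_)
    (trans (ℕ→ℚ-+ (2 ℕ.* z) (s ℕ.* D)) (cong₂ _+_ (ℕ→ℚ-* 2 z) (ℕ→ℚ-* s D)))
    (ℕ→ℚ-mono-≤ g'≤2z+sD)
  qn≡δ-cn : (q - c) * ℕ→ℚ n ≡ ℕ→ℚ δ - c * ℕ→ℚ n
  qn≡δ-cn = trans (solve 3 (λ q c n → (q :- c) :* n := q :* n :- c :* n) refl q c (ℕ→ℚ n))
                  (cong (_- c * ℕ→ℚ n) (/-*-cancel δ n))
  qn<sD : (q - c) * ℕ→ℚ n < ℕ→ℚ s * ℕ→ℚ D
  qn<sD = subst (_< ℕ→ℚ s * ℕ→ℚ D) (sym qn≡δ-cn)
    (deficit-chain (ℕ→ℚ 4 * d + ℕ→ℚ 2 * ε) ε {N = ℕ→ℚ n} {S = ℕ→ℚ s} {D = ℕ→ℚ D}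
                   (ℕ→ℚ-mono-≤ δ≤g) g-AN<g' g'≤2z+sD′ z≤εn)

lemma5p4 : (ε d : ℚ) (M' M n : ℕ) .{{_ : NonZero n}} →
    0ℚ < ε → 0ℚ ≤ d → d ≤ 1ℚ →
    (G G' : StdMultigraph n) → G' ⊑ G →
    (k : ℕ) (part : Fin n → Fin (suc k)) →
    (∀ (i : Fin k) → 0 Data.Nat.< ∣ classOf part (suc i) ∣) →
    ℕ→ℚ ∣ classOf part zero ∣ ≤ ε * ℕ→ℚ n →
    M' Data.Nat.≤ k → k Data.Nat.≤ M →
    (s : ℕ) → (∀ (i : Fin k) → ∣ classOf part (suc i) ∣ ≡ s) →
    k Data.Nat.* s ≡ n ∸ ∣ classOf part zero ∣ →
    (1ℚ - ε) * ℕ→ℚ n ≤ ℕ→ℚ M * ℕ→ℚ s →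
    ℕ→ℚ M' * ℕ→ℚ s ≤ ℕ→ℚ n →
    (∀ (v : Fin n) →
      ℕ→ℚ (deg G v) - (ℕ→ℚ 4 * d + ℕ→ℚ 2 * ε) * ℕ→ℚ n < ℕ→ℚ (deg G' v)) →
    (∀ (i : Fin k) (x y : Fin n) → part x ≡ suc i → part y ≡ suc i →
      μ G' x y ≡ 0) →
    (∀ (i j : Fin k) → i Data.Fin.< j → (c : ℕ) → c ≡ 1 ⊎ c ≡ 2 →
      IsRegular ε G' c (classOf part (suc i)) (classOf part (suc j)) ×
      (density G' c (classOf part (suc i)) (classOf part (suc j)) ≡ 0ℚ ⊎
       d ≤ density G' c (classOf part (suc i)) (classOf part (suc j)))) →
    ((+ minDeg G / n) - (ℕ→ℚ 8 * d + ℕ→ℚ 6 * ε)) * ℕ→ℚ k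
      ≤ ℕ→ℚ (reducedMinDeg d G' part)
lemma5p4 ε d _ _ n 0<ε 0≤d _ G G' _ k part 0<∣Vᵢ∣ ∣V₀∣≤εn _ _ s ∣Vᵢ∣≡s ks≡n∸∣V₀∣ _ _
         deficit noEdgeInClass regularPairs =
  minFin-elim (λ m → bound * ℕ→ℚ k ≤ ℕ→ℚ m) (reducedDeg≤2k d G' part)
              (λ { refl → ℚP.≤-reflexive (ℚP.*-zeroʳ bound) }) clusterBound
  where
  bound : ℚ
  bound = (+ minDeg G / n) - (ℕ→ℚ 8 * d + ℕ→ℚ 6 * ε)
  ks≤n : k ℕ.* s ℕ.≤ n
  ks≤n = ℕP.≤-trans (ℕP.≤-reflexive ks≡n∸∣V₀∣) (ℕP.m∸n≤m n ∣ classOf part zero ∣)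
  dichotomy : ∀ i j → i Data.Fin.< j → ∀ c → c ≡ 1 ⊎ c ≡ 2 →
              density G' c (classOf part (suc i)) (classOf part (suc j)) ≡ 0ℚ ⊎
              d ≤ density G' c (classOf part (suc i)) (classOf part (suc j))
  dichotomy i j i<j c c∈ = proj₂ (regularPairs i j i<j c c∈)
  clusterBound : ∀ i → bound * ℕ→ℚ k ≤ ℕ→ℚ (reducedDeg d G' part i)
  clusterBound i =
    let x , x∈Vᵢ = 0<∣p∣⇒Nonempty (classOf part (suc i)) (0<∣Vᵢ∣ i) in
    scaled-degree-bound {ε} {d} {minDeg G} {deg G x} {deg G' x} {∣ classOf part zero ∣} {s}
                        {reducedDeg d G' part i} {k} {n}
      (ℚP.<⇒≤ 0<ε) 0≤d (minFin≤ (2 ℕ.* n) (deg G) x) (deficit x)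
      (deg≤reducedDeg d G' part noEdgeInClass dichotomy s ∣Vᵢ∣≡s (∈-classOf⁻ part x∈Vᵢ))
      ∣V₀∣≤εn ks≤n
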